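{- Let $\mathcal{I}^A,\mathcal{I}^B$ be instances on the same graph $G=(W\cup F,E)$ that differ only in the preference order of agent $x$, let $e=\{x,y\}\in E$, and let $\mathcal{I}^H$ be the hybrid instance with respect to $e$. Let $M$ be a matching with $e\in M$. (1) If $M$ is robust popular with respect to $\mathcal{I}^A$ and $\mathcal{I}^B$, then $M$ is popular for $\mathcal{I}^H$. (2) If $M$ is robust dominant with respect to $\mathcal{I}^A$ and $\mathcal{I}^B$, then $M$ is dominant for $\mathcal{I}^H$.
   Context: An instance $\mathcal{I}$ of matchings under preferences consists of a finite bipartite graph $(W\cup F,E)$ and, for every agent $z$, a strict linear order $\succ_z^{\mathcal{I}}$ over its neighbour set $N_z$. A matching is a set of pairwise disjoint edges; $M(z)$ is the partner of matched $z$. Agent $z$ prefers $M$ over $M'$ if $z$ is matched in $M$ and unmatched in $M'$, or matched in both and $M(z)\succ_z M'(z)$; $\mathrm{vote}_z(M,M')$ is $1$, $-1$, $0$ accordingly, and $\Delta^{\mathcal{I}}(M,M')=\sum_z\mathrm{vote}_z(M,M')$. $M$ is popular if $\Delta^{\mathcal{I}}(M,M')\ge 0$ for all matchings $M'$, dominant if popular and $\Delta^{\mathcal{I}}(M,M')>0$ for all $M'$ with $|M'|>|M|$; robust popular/dominant means popular/dominant in both $\mathcal{I}^A$ and $\mathcal{I}^B$. Hybrid instance: let $P^A=\{z: z\succ_x^A y\}$, $P^B=\{z: z\succ_x^B y\}$, and let $\succ'$ be any linear order on $N_x$ with $z\succ' y$ for all $z\in P^A\cup P^B$ and $y\succ'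 z$ for all $z\in N_x\setminus(P^A\cup P^B\cup\{y\})$. $\mathcal{I}^H$ is the instance on $G$ where every agent $z\ne x$ has order $\succ_z^A$ and $x$ has order $\succ'$. -}

module Defs where

open import Data.Nat as ℕ using (ℕ)
open import Data.Integer as ℤ using (ℤ; 0ℤ; 1ℤ; -1ℤ)
open import Data.Fin as Fin using (Fin)
open import Data.Bool using (Bool; true; false; if_then_else_)
open import Data.Maybe using (Maybe; just; nothing)
open import Data.Sum using (_⊎_; inj₁; inj₂)
open import Data.Sum.Properties using (≡-dec)
open import Data.Product using (_×_; _,_)
open import Data.List using (List; map; _++_; foldr; allFin)
open import Relation.Binary.PropositionalEquality using (_≡_; _≢_)
open import Relation.Nullary using (yes; no)

record Graph : Set where
  field
    nW : ℕ
    nF : ℕ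
    E  : Fin nW → Fin nF → Bool

module _ (G : Graph) where
  open Graph G

  Agent : Set
  Agent = Fin nW ⊎ Fin nF

  _≟A_ : (a b : Agent) → Relation.Nullary.Dec (a ≡ b)
  _≟A_ = ≡-dec Fin._≟_ Fin._≟_

  Adj : Agent → Agent → Bool
  Adj (inj₁ w) (inj₂ f) = E w f
  Adj (inj₂ f) (inj₁ w) = E w f
  Adj _ _ = false

  agents : List Agent
  agents = map inj₁ (allFin nW) ++ map inj₂ (allFin nF)

  -- r is a strict linear order over the neighbour set N_z of z
  -- (r a b ≡ true means  a ≻_z b)
  record StrictLinOrderOn (z : Agent) (r : Agent → Agent → Bool) : Set where
    field
      onN   : ∀ a b → r a b ≡ true → (Adj z a ≡ true) × (Adj z b ≡ true)
      irrefl : ∀ a → r a a ≡ false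
      trans  : ∀ a b c → r a b ≡ true → r b c ≡ true → r a c ≡ true
      total  : ∀ a b → Adj z a ≡ true → Adj z b ≡ true → a ≢ b →
               (r a b ≡ true) ⊎ (r b a ≡ true)

  -- preference profile: Pref z a b ≡ true  iff  a ≻_z b
  Pref : Set
  Pref = Agent → Agent → Agent → Bool

  IsInstance : Pref → Set
  IsInstance p = ∀ z → StrictLinOrderOn z (p z)

  record Matching : Set where
    field
      partner : Agent → Maybe Agent
      sym     : ∀ a b → partner a ≡ just b → partner b ≡ just a
      edge    : ∀ a b → partner a ≡ just b → Adj a b ≡ true
  open Matching public

  -- |M| = number of edges = number of matched workers
  size : Matching → ℕ
  size M = foldr (λ w n → cnt (partner M (inj₁ w)) ℕ.+ n) 0 (allFin nW)
    where
      cnt : Maybe Agent → ℕ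
      cnt (just _) = 1
      cnt nothing  = 0

  vote : Pref → Agent → Matching → Matching → ℤ
  vote p z M M' = go (partner M z) (partner M' z)
    where
      go : Maybe Agent → Maybe Agent → ℤ
      go (just a) (just b) = if p z a b then 1ℤ else (if p z b a then -1ℤ else 0ℤ)
      go (just _) nothing  = 1ℤ
      go nothing  (just _) = -1ℤ
      go nothing  nothing  = 0ℤ

  Δ : Pref → Matching → Matching → ℤ
  Δ p M M' = foldr (λ z s → vote p z M M' ℤ.+ s) 0ℤ agents

  Popular : Pref → Matching → Set
  Popular p M = ∀ (M' : Matching) → 0ℤ ℤ.≤ Δ p M M'

  Dominant : Pref → Matching → Set
  Dominant p M = Popular p M × (∀ (M' : Matching) → size M ℕ.< size M' → 0ℤ ℤ.< Δ p M M')

  DifferOnlyAt : Agent → Pref → Pref → Set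
  DifferOnlyAt x pA pB = ∀ z → z ≢ x → ∀ a b → pA z a b ≡ pB z a b

  HybridOrder : Pref → Pref → Agent → Agent → (Agent → Agent → Bool) → Set
  HybridOrder pA pB x y r =
    StrictLinOrderOn x r
    × (∀ z → (pA x z y ≡ true ⊎ pB x z y ≡ true) → r z y ≡ true)
    × (∀ z → Adj x z ≡ true → pA x z y ≡ false → pB x z y ≡ false → z ≢ y → r y z ≡ true)

  hybrid : Pref → Agent → (Agent → Agent → Bool) → Pref
  hybrid pA x r z with z ≟A x
  ... | yes _ = r
  ... | no  _ = pA z

{-# OPTIONS --safe #-}
module Submission where

-- Every agent other than x ranks the same way in I^H as in I^A and I^B, and,
-- because M(x) = y, x's vote between M and any M' only depends on how x
-- ranks M'(x) against y.  The hybrid order places each neighbour of x on the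
-- same side of y as ≻^A_x or as ≻^B_x does, so Δ^H(M, M') equals Δ^A(M, M')
-- or Δ^B(M, M'), and popularity and dominance transfer from I^A, I^B to I^H.

open import Defs hiding (sym)
open import Data.Bool using (Bool; true; false; _≟_)
open import Data.Bool.Properties using (¬-not)
open import Data.Maybe using (just; nothing)
open import Data.Maybe.Properties using (just-injective)
open import Data.Product using (_×_; _,_; proj₁; proj₂)
open import Data.Sum as Sum using (_⊎_; inj₁; inj₂)
open import Data.Integer as ℤ using (ℤ; 0ℤ)
open import Data.List.Properties using (foldr-cong)
open import Function using (_∘_)
open import Relation.Nullary using (yes; no; contradiction)
open import Relation.Binary.PropositionalEquality

module _ {G : Graph} {z : Agent G} {s : Agent G → Agent G → Bool}
         (o : StrictLinOrderOn G z s) where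
  open StrictLinOrderOn o renaming (trans to ≻-trans)

  ≻-asym : ∀ {a b} → s a b ≡ true → s b a ≡ false
  ≻-asym {a} {b} ab with s b a in ba
  ... | false = refl
  ... | true  with () ← trans (sym (≻-trans a b a ab ba)) (irrefl a)

  ⊀⇒≻ : ∀ {a b} → Adj G z a ≡ true → Adj G z b ≡ true → a ≢ b →
        s b a ≡ false → s a b ≡ true
  ⊀⇒≻ {a} {b} za zb a≢b ba≡false with total a b za zb a≢b
  ... | inj₁ ab = ab
  ... | inj₂ ba with () ← trans (sym ba) ba≡false

record AgreeOn {A : Set} (s t : A → A → Bool) (a b : A) : Set where
  constructor agreeOn
  field
    forth : s a b ≡ t a b
    back  : s b a ≡ t b a

agreeOn-swap : ∀ {A : Set} {s t : A → A → Bool} {a b} → AgreeOn s t a b → AgreeOn s t b a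
agreeOn-swap (agreeOn ab ba) = agreeOn ba ab

module _ {G : Graph} where

  agreeOn-≻ : ∀ {z z′ s t a b} → StrictLinOrderOn G z s → StrictLinOrderOn G z′ t →
              s a b ≡ true → t a b ≡ true → AgreeOn s t a b
  agreeOn-≻ os ot sab tab =
    agreeOn (trans sab (sym tab)) (trans (≻-asym os sab) (sym (≻-asym ot tab)))

  agreeOn-refl : ∀ {z z′ s t a} → StrictLinOrderOn G z s → StrictLinOrderOn G z′ t →
                 AgreeOn s t a a
  agreeOn-refl {a = a} os ot = agreeOn eq eq
    where eq = trans (StrictLinOrderOn.irrefl os a) (sym (StrictLinOrderOn.irrefl ot a))

module _ {G : Graph} (p q : Pref G) (M M′ : Matching G) where

  vote-cong : ∀ z →
              (∀ {a b} → partner M z ≡ just a → partner M′ z ≡ just b → AgreeOn (p z) (q z) a b) →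
              vote G p z M M′ ≡ vote G q z M M′
  vote-cong z agree with partner M z | partner M′ z
  ... | just a  | just b
    rewrite AgreeOn.forth (agree refl refl) | AgreeOn.back (agree refl refl) = refl
  ... | just _  | nothing = refl
  ... | nothing | just _  = refl
  ... | nothing | nothing = refl

  vote-cong-≗ : ∀ z → (∀ a b → p z a b ≡ q z a b) → vote G p z M M′ ≡ vote G q z M M′
  vote-cong-≗ z p≗q = vote-cong z (λ {a} {b} _ _ → agreeOn (p≗q a b) (p≗q b a))

  Δ-cong : (∀ z → vote G p z M M′ ≡ vote G q z M M′) → Δ G p M M′ ≡ Δ G q M M′
  Δ-cong votes = foldr-cong (λ z s → cong (ℤ._+ s) (votes z)) refl (agents G)

  Δ-cong-at : ∀ x → vote G p x M M′ ≡ vote G q x M M′ →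
              (∀ z → z ≢ x → vote G p z M M′ ≡ vote G q z M M′) →
              Δ G p M M′ ≡ Δ G q M M′
  Δ-cong-at x at-x off-x = Δ-cong votes
    where
      votes : ∀ z → vote G p z M M′ ≡ vote G q z M M′
      votes z with _≟A_ G z x
      ... | yes refl = at-x
      ... | no z≢x   = off-x z z≢x

module _ {G : Graph} where

  hybrid-at : ∀ pA x r a b → hybrid G pA x r x a b ≡ r a b
  hybrid-at pA x r a b with _≟A_ G x x
  ... | yes _   = refl
  ... | no x≢x = contradiction refl x≢x

  hybrid-off : ∀ pA x r {z} → z ≢ x → ∀ a b → hybrid G pA x r z a b ≡ pA z a b
  hybrid-off pA x r {z} z≢x a b with _≟A_ G z x
  ... | yes z≡x = contradiction z≡x z≢x
  ... | no _    = refl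

module HybridInstance
  (G : Graph) (pA pB : Pref G) (iA : IsInstance G pA) (iB : IsInstance G pB)
  (x y : Agent G) (differ : DifferOnlyAt G x pA pB) (xy : Adj G x y ≡ true)
  (r : Agent G → Agent G → Bool) (hybridOrder : HybridOrder G pA pB x y r)
  where

  pH : Pref G
  pH = hybrid G pA x r

  private
    r-order = proj₁ hybridOrder
    above-y = proj₁ (proj₂ hybridOrder)
    below-y = proj₂ (proj₂ hybridOrder)

  agreeOn-y : ∀ {b} → Adj G x b ≡ true → AgreeOn r (pA x) y b ⊎ AgreeOn r (pB x) y b
  agreeOn-y {b} xb with _≟A_ G b y
  ... | yes refl = inj₁ (agreeOn-refl r-order (iA x))
  ... | no b≢y with pA x b y ≟ true
  ...   | yes bAy = inj₁ (agreeOn-swap (agreeOn-≻ r-order (iA x) (above-y b (inj₁ bAy)) bAy))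
  ...   | no bAy≢ with pB x b y ≟ true
  ...     | yes bBy = inj₂ (agreeOn-swap (agreeOn-≻ r-order (iB x) (above-y b (inj₂ bBy)) bBy))
  ...     | no bBy≢ = inj₁ (agreeOn-≻ r-order (iA x) (below-y b xb bAy bBy b≢y)
                                       (⊀⇒≻ (iA x) xy xb (b≢y ∘ sym) bAy))
    where bAy = ¬-not bAy≢
          bBy = ¬-not bBy≢

  agreeOn-pH : ∀ {t a b} → AgreeOn r t a b → AgreeOn (pH x) t a b
  agreeOn-pH {a = a} {b} (agreeOn ab ba) =
    agreeOn (trans (hybrid-at pA x r a b) ab) (trans (hybrid-at pA x r b a) ba)

  module _ (M : Matching G) (M[x]≡y : partner M x ≡ just y) (M′ : Matching G) where

    vote-x-matched : ∀ q {b} → partner M′ x ≡ just b → AgreeOn r (q x) y b →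
                     vote G pH x M M′ ≡ vote G q x M M′
    vote-x-matched q M′[x]≡b agree = vote-cong pH q M M′ x λ M[x]≡a M′[x]≡b′ →
      subst₂ (AgreeOn (pH x) (q x))
             (just-injective (trans (sym M[x]≡y) M[x]≡a))
             (just-injective (trans (sym M′[x]≡b) M′[x]≡b′))
             (agreeOn-pH agree)

    vote-x-unmatched : partner M′ x ≡ nothing → vote G pH x M M′ ≡ vote G pA x M M′
    vote-x-unmatched M′[x]≡nothing = vote-cong pH pA M M′ x λ _ M′[x]≡b →
      contradiction (trans (sym M′[x]≡nothing) M′[x]≡b) λ ()

    vote-x : vote G pH x M M′ ≡ vote G pA x M M′ ⊎ vote G pH x M M′ ≡ vote G pB x M M′
    vote-x = cases (partner M′ x) refl
      where
        -- `with partner M′ x` would also abstract the occurrence inside the unfolded vote.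
        cases : ∀ m → partner M′ x ≡ m →
                vote G pH x M M′ ≡ vote G pA x M M′ ⊎ vote G pH x M M′ ≡ vote G pB x M M′
        cases nothing  M′[x]≡nothing = inj₁ (vote-x-unmatched M′[x]≡nothing)
        cases (just b) M′[x]≡b = Sum.map (vote-x-matched pA M′[x]≡b) (vote-x-matched pB M′[x]≡b)
                                         (agreeOn-y (edge M′ x b M′[x]≡b))

    Δ-hybrid : Δ G pH M M′ ≡ Δ G pA M M′ ⊎ Δ G pH M M′ ≡ Δ G pB M M′
    Δ-hybrid = Sum.map (λ at-x → Δ-cong-at pH pA M M′ x at-x off-x-A)
                       (λ at-x → Δ-cong-at pH pB M M′ x at-x off-x-B) vote-x
      where
        off-x-A : ∀ z → z ≢ x → vote G pH z M M′ ≡ vote G pA z M M′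
        off-x-A z z≢x = vote-cong-≗ pH pA M M′ z (hybrid-off pA x r z≢x)
        off-x-B : ∀ z → z ≢ x → vote G pH z M M′ ≡ vote G pB z M M′
        off-x-B z z≢x = vote-cong-≗ pH pB M M′ z λ a b →
          trans (hybrid-off pA x r z≢x a b) (differ z z≢x a b)

    Δ-hybrid-preserves : (P : ℤ → Set) → P (Δ G pA M M′) → P (Δ G pB M M′) → P (Δ G pH M M′)
    Δ-hybrid-preserves P PA PB with Δ-hybrid
    ... | inj₁ eqA = subst P (sym eqA) PA
    ... | inj₂ eqB = subst P (sym eqB) PB

lemma2 : (G : Graph) (pA pB : Pref G) → IsInstance G pA → IsInstance G pB →
         (x y : Agent G) → DifferOnlyAt G x pA pB → Adj G x y ≡ true →
         (r : Agent G → Agent G → Bool) → HybridOrder G pA pB x y r →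
         (M : Matching G) → partner M x ≡ just y →
         ((Popular G pA M × Popular G pB M) → Popular G (hybrid G pA x r) M)
         × ((Dominant G pA M × Dominant G pB M) → Dominant G (hybrid G pA x r) M)
lemma2 G pA pB iA iB x y differ xy r hybridOrder M M[x]≡y = popular , dominant
  where
    open HybridInstance G pA pB iA iB x y differ xy r hybridOrder

    popular : Popular G pA M × Popular G pB M → Popular G pH M
    popular (popA , popB) M′ = Δ-hybrid-preserves M M[x]≡y M′ (0ℤ ℤ.≤_) (popA M′) (popB M′)

    dominant : Dominant G pA M × Dominant G pB M → Dominant G pH M
    dominant ((popA , domA) , (popB , domB)) =
      popular (popA , popB) , λ M′ |M|<|M′| →
        Δ-hybrid-preserves M M[x]≡y M′ (0ℤ ℤ.<_) (domA M′ |M|<|M′|) (domB M′ |M|<|M′|)
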